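{- Let $k\ge1$, let $G=(V,E)$ be a graph and let $\alpha,\beta$ be proper $k$-colourings of $G$ such that an $(\alpha\to\beta)$-recolouring exists, and let $\ell\ge 1$ be the minimum length of an $(\alpha\to\beta)$-recolouring. Then the set $A^*=\bigcup_{h=0}^{\ell-1}A_h$ has size $|A^*|\le \ell\cdot(k\ell)^{\ell}$.
   Context: A proper $k$-colouring of $G$ is a map $c:V\to\{1,\dots,k\}$ with $c(x)\ne c(y)$ for all $xy\in E$. An $(\alpha\to\beta)$-recolouring of length $\ell$ is a sequence $c_0=\alpha,\dots,c_\ell=\beta$ of proper $k$-colourings in which consecutive colourings disagree on at most one vertex. For $u\in V$, $N(u)$ is its set of neighbours, and for $v\in N(u)$, $N(u,v)=\{w\in N(u):\alpha(w)=\alpha(v)\}$. Let $A_0=\{v\in V:\alpha(v)\ne\beta(v)\}$ and, for $i\ge1$, $A_i=\bigcup_{u\in A_{i-1}}\{v\in N(u): |N(u,v)|\le\ell\}$. -}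

module Defs where

open import Data.Nat using (ℕ; zero; suc; _≤ᵇ_)
open import Data.Bool using (Bool; true; false; _∧_; not)
open import Data.Fin using (Fin; _≟_)
open import Data.Fin.Subset using (Subset; ⊥; _∪_; ∣_∣)
open import Data.Vec using (tabulate; lookup)
open import Data.List using (allFin)
open import Data.Bool.ListAction using (any)
open import Data.Product using (∃)
open import Relation.Nullary using (¬_)
open import Relation.Nullary.Decidable using (⌊_⌋)
open import Relation.Binary.PropositionalEquality using (_≡_; _≢_)

record Graph : Set where
  field
    n     : ℕ
    adj   : Fin n → Fin n → Bool
    sym   : ∀ x y → adj x y ≡ adj y x
    irrefl : ∀ x → adj x x ≡ false
open Graph public

Colouring : Graph → ℕ → Set
Colouring G k = Fin (n G) → Fin k

Proper : (G : Graph) (k : ℕ) → Colouring G k → Set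
Proper G k c = ∀ x y → adj G x y ≡ true → c x ≢ c y

AtMostOneDiff : (G : Graph) (k : ℕ) → Colouring G k → Colouring G k → Set
AtMostOneDiff G k c c' = ∃ λ v → ∀ w → ¬ (w ≡ v) → c w ≡ c' w

data Recolouring (G : Graph) (k : ℕ) : Colouring G k → Colouring G k → ℕ → Set where
  done : ∀ {c} → Proper G k c → Recolouring G k c c zero
  step : ∀ {c c' β ℓ} → Proper G k c → AtMostOneDiff G k c c' →
         Recolouring G k c' β ℓ → Recolouring G k c β (suc ℓ)

module _ (G : Graph) (k : ℕ) (α β : Colouring G k) (ℓ : ℕ) where

  Nuv : Fin (n G) → Fin (n G) → Subset (n G)
  Nuv u v = tabulate (λ w → adj G u w ∧ ⌊ α w ≟ α v ⌋)

  -- A₀ = { v : α(v) ≠ β(v) },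
  -- A_{i+1} = ⋃_{u ∈ A_i} { v ∈ N(u) : |N(u,v)| ≤ ℓ }
  A : ℕ → Subset (n G)
  A zero    = tabulate (λ v → not ⌊ α v ≟ β v ⌋)
  A (suc i) = tabulate (λ v → any (λ u → lookup (A i) u ∧ adj G u v ∧ (∣ Nuv u v ∣ ≤ᵇ ℓ)) (allFin (n G)))

  AUpTo : ℕ → Subset (n G)
  AUpTo zero    = ⊥
  AUpTo (suc h) = AUpTo h ∪ A h

  Astar : Subset (n G)
  Astar = AUpTo ℓ

-- A₀ lies inside the at most ℓ vertices recoloured along a recolouring of
-- length ℓ. A vertex u has at most kℓ neighbours v with |N(u,v)| ≤ ℓ: those
-- of a fixed colour all lie in N(u,v₀) for any one of them, v₀. Hence
-- |A_h| ≤ ℓ(kℓ)^h ≤ (kℓ)^ℓ for h < ℓ, and A* is a union of ℓ such sets.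
module Submission where

open import Defs hiding (sym)
open import Data.Nat using (ℕ; zero; suc; NonZero; _+_; _*_; _^_; _≤_; _<_; _≤ᵇ_; z≤n; s≤s)
open import Data.Nat.Properties
  using (≤-refl; ≤-trans; ≤-reflexive; n≤1+n; m<n⇒m<1+n; m≤n*m; +-suc; +-comm; +-mono-≤; +-monoʳ-≤;
         *-monoˡ-≤; *-assoc; *-comm; *-identityʳ; ^-monoʳ-≤; ≤ᵇ⇒≤; module ≤-Reasoning)
open import Data.Bool using (Bool; T; _∧_)
open import Data.Bool.Properties using (T-≡; T-∧)
open import Data.Fin using (Fin; _≟_)
import Data.Fin as Fin
open import Data.Fin.Subset using (Subset; inside; outside; _∈_; _∉_; _⊆_; _∪_; _∩_; ⊥; ⊤; ⁅_⁆; ∣_∣)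
open import Data.Fin.Subset.Properties
  using (_∈?_; nonempty?; Empty-unique; ∣⊥∣≡0; ∣⊤∣≡n; ∈⊤; ∣⁅x⁆∣≡1; x∈⁅x⁆; p⊆q⇒∣p∣≤∣q∣;
         x∈p∪q⁺; x∈p∩q⁺; x∈p∩q⁻)
open import Data.Vec using (_∷_; []; tabulate; lookup; here; there)
open import Data.Vec.Properties using (lookup∘tabulate; []=⇒lookup; lookup⇒[]=)
open import Data.List using (allFin)
open import Data.List.Relation.Unary.Any using (satisfied)
open import Data.List.Relation.Unary.Any.Properties using (any⁻)
open import Data.Product using (_,_; _×_; proj₁; proj₂)
open import Data.Sum using (inj₁; inj₂)
open import Function using (_∘_; Equivalence)
open import Relation.Nullary using (¬_; yes; no; contradiction)
open import Relation.Nullary.Decidable using (⌊_⌋; toWitness; fromWitness; toWitnessFalse)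
open import Relation.Binary.PropositionalEquality using (_≡_; refl; sym; trans; cong)

open Equivalence using (to; from)

private
  variable
    d b : ℕ

∈-tabulate⁻ : {f : Fin d → Bool} {x : Fin d} → x ∈ tabulate f → T (f x)
∈-tabulate⁻ {f = f} {x} x∈ = from T-≡ (trans (sym (lookup∘tabulate f x)) ([]=⇒lookup x∈))

∈-tabulate⁺ : {f : Fin d → Bool} {x : Fin d} → T (f x) → x ∈ tabulate f
∈-tabulate⁺ {f = f} {x} fx = lookup⇒[]= x (tabulate f) (trans (lookup∘tabulate f x) (to T-≡ fx))

T-lookup⇒∈ : {p : Subset d} {x : Fin d} → T (lookup p x) → x ∈ p
T-lookup⇒∈ {p = p} {x} px = lookup⇒[]= x p (to T-≡ px)

∣p∪q∣≤∣p∣+∣q∣ : (p q : Subset d) → ∣ p ∪ q ∣ ≤ ∣ p ∣ + ∣ q ∣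
∣p∪q∣≤∣p∣+∣q∣ []            []            = z≤n
∣p∪q∣≤∣p∣+∣q∣ (inside  ∷ p) (inside  ∷ q) =
  s≤s (≤-trans (∣p∪q∣≤∣p∣+∣q∣ p q) (+-monoʳ-≤ ∣ p ∣ (n≤1+n ∣ q ∣)))
∣p∪q∣≤∣p∣+∣q∣ (inside  ∷ p) (outside ∷ q) = s≤s (∣p∪q∣≤∣p∣+∣q∣ p q)
∣p∪q∣≤∣p∣+∣q∣ (outside ∷ p) (inside  ∷ q) =
  ≤-trans (s≤s (∣p∪q∣≤∣p∣+∣q∣ p q)) (≤-reflexive (sym (+-suc ∣ p ∣ ∣ q ∣)))
∣p∪q∣≤∣p∣+∣q∣ (outside ∷ p) (outside ∷ q) = ∣p∪q∣≤∣p∣+∣q∣ p q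

∣p∣≤-fromElement : {p : Subset d} → (∀ {x} → x ∈ p → ∣ p ∣ ≤ b) → ∣ p ∣ ≤ b
∣p∣≤-fromElement {d} {p = p} bound with nonempty? p
... | yes (x , x∈p) = bound x∈p
... | no  empty rewrite Empty-unique empty | ∣⊥∣≡0 d = z≤n

⋃[_] : ∀ {m} → Subset m → (Fin m → Subset d) → Subset d
⋃[ []          ] F = ⊥
⋃[ inside  ∷ p ] F = F Fin.zero ∪ ⋃[ p ] (F ∘ Fin.suc)
⋃[ outside ∷ p ] F = ⋃[ p ] (F ∘ Fin.suc)

∈-⋃⁺ : ∀ {m} {p : Subset m} {F : Fin m → Subset d} {u x} → u ∈ p → x ∈ F u → x ∈ ⋃[ p ] F
∈-⋃⁺ {p = inside  ∷ p}     here         x∈Fu = x∈p∪q⁺ (inj₁ x∈Fu)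
∈-⋃⁺ {p = inside  ∷ p} {F} (there u∈p) x∈Fu = x∈p∪q⁺ (inj₂ (∈-⋃⁺ {F = F ∘ Fin.suc} u∈p x∈Fu))
∈-⋃⁺ {p = outside ∷ p} {F} (there u∈p) x∈Fu = ∈-⋃⁺ {F = F ∘ Fin.suc} u∈p x∈Fu

∣⋃∣≤∣p∣* : ∀ {m} (p : Subset m) (F : Fin m → Subset d) →
           (∀ {u} → u ∈ p → ∣ F u ∣ ≤ b) → ∣ ⋃[ p ] F ∣ ≤ ∣ p ∣ * b
∣⋃∣≤∣p∣* {d} []            F bound = ≤-reflexive (∣⊥∣≡0 d)
∣⋃∣≤∣p∣* (inside  ∷ p) F bound =
  ≤-trans (∣p∪q∣≤∣p∣+∣q∣ (F Fin.zero) (⋃[ p ] (F ∘ Fin.suc)))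
          (+-mono-≤ (bound here) (∣⋃∣≤∣p∣* p (F ∘ Fin.suc) (bound ∘ there)))
∣⋃∣≤∣p∣* (outside ∷ p) F bound = ∣⋃∣≤∣p∣* p (F ∘ Fin.suc) (bound ∘ there)

module _ {G : Graph} {k : ℕ} where

  recoloured : ∀ {c β ℓ} → Recolouring G k c β ℓ → Subset (n G)
  recoloured (done _)              = ⊥
  recoloured (step _ (v , _) rest) = ⁅ v ⁆ ∪ recoloured rest

  ∣recoloured∣≤length : ∀ {c β ℓ} (r : Recolouring G k c β ℓ) → ∣ recoloured r ∣ ≤ ℓ
  ∣recoloured∣≤length (done _)              = ≤-reflexive (∣⊥∣≡0 (n G))
  ∣recoloured∣≤length (step _ (v , _) rest) =
    ≤-trans (∣p∪q∣≤∣p∣+∣q∣ ⁅ v ⁆ (recoloured rest))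
            (+-mono-≤ (≤-reflexive (∣⁅x⁆∣≡1 v)) (∣recoloured∣≤length rest))

  ∉recoloured⇒unchanged : ∀ {c β ℓ} (r : Recolouring G k c β ℓ) {w} → w ∉ recoloured r → c w ≡ β w
  ∉recoloured⇒unchanged (done _)                 w∉ = refl
  ∉recoloured⇒unchanged (step _ (v , same) rest) {w} w∉ =
    trans (same w (λ { refl → w∉ (x∈p∪q⁺ (inj₁ (x∈⁅x⁆ v))) }))
          (∉recoloured⇒unchanged rest (w∉ ∘ x∈p∪q⁺ ∘ inj₂))

m*x^h≤x^j : ∀ {m h j} x .{{_ : NonZero x}} → m ≤ x → h < j → m * x ^ h ≤ x ^ j
m*x^h≤x^j x m≤x h<j = ≤-trans (*-monoˡ-≤ _ m≤x) (^-monoʳ-≤ x h<j)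

module _ (G : Graph) (k : ℕ) (α β : Colouring G k) (ℓ : ℕ) where

  private
    𝒜 : ℕ → Subset (n G)
    𝒜 = A G k α β ℓ

    N : Fin (n G) → Fin (n G) → Subset (n G)
    N = Nuv G k α β ℓ

  sparseNeighbours : Fin (n G) → Subset (n G)
  sparseNeighbours u = tabulate (λ v → adj G u v ∧ (∣ N u v ∣ ≤ᵇ ℓ))

  colourClass : Fin k → Subset (n G)
  colourClass c = tabulate (λ v → ⌊ α v ≟ c ⌋)

  ∣colourClass∩sparseNeighbours∣≤ℓ : ∀ c u → ∣ colourClass c ∩ sparseNeighbours u ∣ ≤ ℓ
  ∣colourClass∩sparseNeighbours∣≤ℓ c u = ∣p∣≤-fromElement λ {v₀} v₀∈ →
    ≤-trans (p⊆q⇒∣p∣≤∣q∣ (⊆N v₀∈)) (≤ᵇ⇒≤ _ _ (proj₂ (sparse v₀∈)))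
    where
    S : Subset (n G)
    S = colourClass c ∩ sparseNeighbours u

    colour : ∀ {v} → v ∈ S → α v ≡ c
    colour v∈ = toWitness (∈-tabulate⁻ (proj₁ (x∈p∩q⁻ _ _ v∈)))

    sparse : ∀ {v} → v ∈ S → T (adj G u v) × T (∣ N u v ∣ ≤ᵇ ℓ)
    sparse v∈ = to T-∧ (∈-tabulate⁻ (proj₂ (x∈p∩q⁻ _ _ v∈)))

    ⊆N : ∀ {v₀} → v₀ ∈ S → S ⊆ N u v₀
    ⊆N v₀∈ v∈ = ∈-tabulate⁺ (from T-∧ (proj₁ (sparse v∈) , fromWitness (trans (colour v∈) (sym (colour v₀∈)))))

  ∣sparseNeighbours∣≤kℓ : ∀ u → ∣ sparseNeighbours u ∣ ≤ k * ℓ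
  ∣sparseNeighbours∣≤kℓ u = begin
    ∣ sparseNeighbours u ∣                                    ≤⟨ p⊆q⇒∣p∣≤∣q∣ byColour ⟩
    ∣ ⋃[ ⊤ ] (λ c → colourClass c ∩ sparseNeighbours u) ∣    ≤⟨ ∣⋃∣≤∣p∣* ⊤ _ (λ {c} _ → ∣colourClass∩sparseNeighbours∣≤ℓ c u) ⟩
    ∣ ⊤ {k} ∣ * ℓ                                             ≡⟨ cong (_* ℓ) (∣⊤∣≡n k) ⟩
    k * ℓ                                                     ∎
    where
    open ≤-Reasoning
    byColour : sparseNeighbours u ⊆ ⋃[ ⊤ ] (λ c → colourClass c ∩ sparseNeighbours u)
    byColour {v} v∈ = ∈-⋃⁺ (∈⊤ {x = α v}) (x∈p∩q⁺ (∈-tabulate⁺ (fromWitness refl) , v∈))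

  A-suc⊆⋃sparseNeighbours : ∀ i → 𝒜 (suc i) ⊆ ⋃[ 𝒜 i ] sparseNeighbours
  A-suc⊆⋃sparseNeighbours i {v} v∈ with satisfied (any⁻ _ (allFin (n G)) (∈-tabulate⁻ v∈))
  ... | u , witness with to (T-∧ {lookup (𝒜 i) u}) witness
  ... | u∈Aᵢ , v∈sparse = ∈-⋃⁺ {p = 𝒜 i} {F = sparseNeighbours} (T-lookup⇒∈ u∈Aᵢ) (∈-tabulate⁺ v∈sparse)

  A₀⊆recoloured : (r : Recolouring G k α β ℓ) → 𝒜 0 ⊆ recoloured r
  A₀⊆recoloured r {v} v∈ with v ∈? recoloured r
  ... | yes v∈r = v∈r
  ... | no  v∉r = contradiction (∉recoloured⇒unchanged r v∉r) (toWitnessFalse (∈-tabulate⁻ v∈))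

  ∣A∣≤ : Recolouring G k α β ℓ → ∀ h → ∣ 𝒜 h ∣ ≤ ℓ * (k * ℓ) ^ h
  ∣A∣≤ r zero    = ≤-trans (p⊆q⇒∣p∣≤∣q∣ (A₀⊆recoloured r))
                           (≤-trans (∣recoloured∣≤length r) (≤-reflexive (sym (*-identityʳ ℓ))))
  ∣A∣≤ r (suc h) = begin
    ∣ 𝒜 (suc h) ∣                   ≤⟨ p⊆q⇒∣p∣≤∣q∣ (A-suc⊆⋃sparseNeighbours h) ⟩
    ∣ ⋃[ 𝒜 h ] sparseNeighbours ∣   ≤⟨ ∣⋃∣≤∣p∣* (𝒜 h) _ (λ {u} _ → ∣sparseNeighbours∣≤kℓ u) ⟩
    ∣ 𝒜 h ∣ * (k * ℓ)               ≤⟨ *-monoˡ-≤ (k * ℓ) (∣A∣≤ r h) ⟩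
    ℓ * (k * ℓ) ^ h * (k * ℓ)       ≡⟨ *-assoc ℓ _ (k * ℓ) ⟩
    ℓ * ((k * ℓ) ^ h * (k * ℓ))     ≡⟨ cong (ℓ *_) (*-comm ((k * ℓ) ^ h) (k * ℓ)) ⟩
    ℓ * (k * ℓ) ^ suc h             ∎
    where open ≤-Reasoning

  ∣AUpTo∣≤ : ∀ m → (∀ h → h < m → ∣ 𝒜 h ∣ ≤ b) → ∣ AUpTo G k α β ℓ m ∣ ≤ m * b
  ∣AUpTo∣≤ zero        _     = ≤-reflexive (∣⊥∣≡0 (n G))
  ∣AUpTo∣≤ {b} (suc m) bound = begin
    ∣ AUpTo G k α β ℓ m ∪ 𝒜 m ∣       ≤⟨ ∣p∪q∣≤∣p∣+∣q∣ (AUpTo G k α β ℓ m) (𝒜 m) ⟩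
    ∣ AUpTo G k α β ℓ m ∣ + ∣ 𝒜 m ∣   ≤⟨ +-mono-≤ (∣AUpTo∣≤ m (λ h h<m → bound h (m<n⇒m<1+n h<m)))
                                                  (bound m ≤-refl) ⟩
    m * b + b                         ≡⟨ +-comm (m * b) b ⟩
    suc m * b                         ∎
    where open ≤-Reasoning

lemma17 : (k : ℕ) → 1 ≤ k → (G : Graph) → (α β : Colouring G k) →
          Proper G k α → Proper G k β → (ℓ : ℕ) → 1 ≤ ℓ →
          Recolouring G k α β ℓ →
          (∀ m → m < ℓ → ¬ Recolouring G k α β m) →
          ∣ Astar G k α β ℓ ∣ ≤ ℓ * (k * ℓ) ^ ℓ
lemma17 k@(suc _) (s≤s z≤n) G α β _ _ ℓ@(suc _) (s≤s z≤n) r _ =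
  ∣AUpTo∣≤ G k α β ℓ ℓ λ h h<ℓ →
    ≤-trans (∣A∣≤ G k α β ℓ r h) (m*x^h≤x^j (k * ℓ) (m≤n*m ℓ k) h<ℓ)
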